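{- Let $G$ be a graph with vertex set $V$ and let $W\subseteq V$ be reducible in $G$. Then the nullity of $W$ in $G$ equals the number of times the negative rule $\mathrm{gnr}$ is applied in any applicable combinatorial reduction strategy of $G$ whose domain is $W$.
   Context: A graph is a finite graph with vertex set $V$, no multiple edges, in which each vertex may or may not carry a loop (looped vertices are "positive", loopless ones "negative"). Its adjacency matrix $A$ is the symmetric $V\times V$ matrix over $\mathbf{F}_2$ with $A_{vw}=1$ iff $v\ne w$ are adjacent and $A_{vv}=1$ iff $v$ has a loop. Let $\mathcal{V}$ be the $\mathbf{F}_2$-vector space with basis $V$, $\mathcal{E}(x,y)=x^TAy$, $\langle W\rangle$ the span of $W\subseteq V$, and $\langle W\rangle^{\perp}=\{x:\mathcal{E}(x,w)=0\ \forall w\in\langle W\rangle\}$. $W$ is reducible in $G$ if $\langle W\rangle+\langle W\rangle^{\perp}=\mathcal{V}$. The nullity of $W$ in $G$ is $|W|-\mathrm{rank}(A_{W,W})$, where $A_{W,W}$ is the principal submatrix on rows and columns $W$ and rank is over $\mathbf{F}_2$. Combinatorial reduction rules (with the domain listed first in block form, arithmetic over $\mathbf{F}_2$): $\mathrm{gpr}_v$ (positive rule) applies iff $v$ has a loop; its domain is $\{v\}$; if $A=\begin{pmatrix}1&q\\ q^T&R\end{pmatrix}$, the result is the graph on $V\setminus\{v\}$ with adjacency matrix $R-q^Tq$. $\mathrm{gdr}_{v_1,v_2}$ (double rule) applies iff $v_1\neq v_2$ are both loopless and adjacent; its domain is $\{v_1,v_2\}$; if $A=\begin{pmatrix}J&Q\\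 Q^T&R\end{pmatrix}$ with $J=\begin{pmatrix}0&1\\1&0\end{pmatrix}$, the result is the graph on $V\setminus\{v_1,v_2\}$ with adjacency matrix $R-Q^TJQ$. $\mathrm{gnr}_v$ (negative rule) applies iff $v$ is loopless and has no neighbours; its domain is $\{v\}$; the result is $G$ with $v$ deleted. A combinatorial reduction strategy is a sequence $(\gamma_1,\dots,\gamma_k)$ of such rules; it is applicable if each $\gamma_i$ applies to $\gamma_{i-1}\circ\cdots\circ\gamma_1(G)$; its domain is the set of all vertices removed. -}

module Defs where

open import Data.Nat using (ℕ; zero; suc; _+_; _∸_; _≤_)
open import Data.Fin using (Fin; zero; suc)
open import Data.Bool using (Bool; true; false; _∧_; _xor_; if_then_else_)
open import Data.List using (List; []; _∷_)
open import Data.Product using (_×_; ∃; ∃-syntax; Σ-syntax)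
open import Data.Sum using (_⊎_)
open import Data.Unit using (⊤)
open import Data.Empty using (⊥)
open import Relation.Nullary using (¬_; Dec; yes; no)
open import Relation.Binary.PropositionalEquality using (_≡_; _≢_)
open import Data.Fin using (_≟_)

-- F₂ = Bool (xor = +, ∧ = ·). Vertex set V = Fin n.

Vect : ℕ → Set
Vect n = Fin n → Bool

Subset : ℕ → Set
Subset n = Fin n → Bool

Mat : ℕ → Set
Mat n = Fin n → Fin n → Bool

Symmetric : ∀ {n} → Mat n → Set
Symmetric A = ∀ i j → A i j ≡ A j i

⊕Σ : ∀ {n} → (Fin n → Bool) → Bool
⊕Σ {zero}  f = false
⊕Σ {suc n} f = f zero xor ⊕Σ (λ i → f (suc i))

card : ∀ {n} → Subset n → ℕ
card {zero}  W = 0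
card {suc n} W = (if W zero then 1 else 0) + card (λ i → W (suc i))

ℰ : ∀ {n} → Mat n → Vect n → Vect n → Bool
ℰ A x y = ⊕Σ (λ i → x i ∧ ⊕Σ (λ j → A i j ∧ y j))

-- x ∈ ⟨W⟩ : x is an F₂-combination of basis vectors in W,
-- i.e. its support is contained in W
InSpan : ∀ {n} → Subset n → Vect n → Set
InSpan W x = ∀ i → x i ≡ true → W i ≡ true

InPerp : ∀ {n} → Mat n → Subset n → Vect n → Set
InPerp A W x = ∀ w → InSpan W w → ℰ A x w ≡ false

Reducible : ∀ {n} → Mat n → Subset n → Set
Reducible {n} A W = ∀ (z : Vect n) → ∃[ x ] ∃[ y ]
  (InSpan W x × InPerp A W y × (∀ i → z i ≡ (x i xor y i)))

-- the columns of A_{W,W} indexed by C ⊆ W are linearly independent: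
-- every F₂-combination (coefficients λ supported on C) that vanishes
-- on all rows of W is trivial
IndepCols : ∀ {n} → Mat n → Subset n → Subset n → Set
IndepCols {n} A W C = ∀ (λc : Vect n) → InSpan C λc →
  (∀ i → W i ≡ true → ⊕Σ (λ c → λc c ∧ A i c) ≡ false) →
  ∀ c → λc c ≡ false

IsRank : ∀ {n} → Mat n → Subset n → ℕ → Set
IsRank A W r =
  (∃[ C ] (InSpan W C × IndepCols A W C × card C ≡ r)) ×
  (∀ C → InSpan W C → IndepCols A W C → card C ≤ r)

IsNullity : ∀ {n} → Mat n → Subset n → ℕ → Set
IsNullity A W k = ∃[ r ] (IsRank A W r × k ≡ card W ∸ r)

-- A graph during reduction is kept with the original vertex labels:
-- a set S ⊆ Fin n of remaining vertices together with a matrix whose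
-- entries on S × S are the adjacency matrix of the current graph.

record State (n : ℕ) : Set where
  constructor st
  field
    verts : Subset n
    adj   : Mat n
open State public

data Rule (n : ℕ) : Set where
  gpr : Fin n → Rule n
  gdr : Fin n → Fin n → Rule n
  gnr : Fin n → Rule n

remove : ∀ {n} → Fin n → Subset n → Subset n
remove v S w with w ≟ v
... | yes _ = false
... | no  _ = S w

Applies : ∀ {n} → Rule n → State n → Set
Applies (gpr v) (st S A) = S v ≡ true × A v v ≡ true
Applies (gdr v₁ v₂) (st S A) =
  v₁ ≢ v₂ × S v₁ ≡ true × S v₂ ≡ true ×
  A v₁ v₁ ≡ false × A v₂ v₂ ≡ false × A v₁ v₂ ≡ true
Applies (gnr v) (st S A) =
  S v ≡ true × A v v ≡ false × (∀ w → S w ≡ true → w ≢ v → A v w ≡ false)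

apply : ∀ {n} → Rule n → State n → State n
-- R - qᵀq
apply (gpr v) (st S A) =
  st (remove v S) (λ x y → A x y xor (A v x ∧ A v y))
-- R - Qᵀ J Q
apply (gdr v₁ v₂) (st S A) =
  st (remove v₂ (remove v₁ S))
     (λ x y → A x y xor ((A v₁ x ∧ A v₂ y) xor (A v₂ x ∧ A v₁ y)))
apply (gnr v) (st S A) = st (remove v S) A

InRuleDom : ∀ {n} → Rule n → Fin n → Set
InRuleDom (gpr v) x = x ≡ v
InRuleDom (gdr v₁ v₂) x = x ≡ v₁ ⊎ x ≡ v₂
InRuleDom (gnr v) x = x ≡ v

InDom : ∀ {n} → List (Rule n) → Fin n → Set
InDom [] x = ⊥
InDom (γ ∷ σ) x = InRuleDom γ x ⊎ InDom σ x

Applicable : ∀ {n} → State n → List (Rule n) → Set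
Applicable s [] = ⊤
Applicable s (γ ∷ σ) = Applies γ s × Applicable (apply γ s) σ

countGnr : ∀ {n} → List (Rule n) → ℕ
countGnr [] = 0
countGnr (gpr _ ∷ σ) = countGnr σ
countGnr (gdr _ _ ∷ σ) = countGnr σ
countGnr (gnr _ ∷ σ) = suc (countGnr σ)

graph : ∀ {n} → Mat n → State n
graph A = st (λ _ → true) A

module Submission where

-- Write A_{W,W} for the principal submatrix on W.  We show that every
-- applicable strategy σ with domain W produces a column basis B ⊆ W of
-- A_{W,W} (columns independent on the rows W, and every column of A_{W,W}
-- a combination of them) with |W| = |B| + #gnr(σ).  This is an induction
-- along σ: the positive and double rules are Schur-complement pivots on a
-- block (1) resp. (0 1; 1 0), which is invertible, and a pivot turns a column
-- basis of the reduced matrix into one of the original matrix after adding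
-- the pivot vertices (lemma 'pivot-extend'); the negative rule deletes a
-- vertex whose row and column vanish, which keeps the basis and contributes
-- one to the nullity ('isolated-extend').  By the Steinitz exchange lemma
-- ('exchange') no independent set of columns is larger than a basis, so the
-- rank of A_{W,W} is |B| and the nullity is |W| - |B| = #gnr(σ).

open import Defs
open import Algebra.Bundles using (CommutativeRing)
import Algebra.Properties.CommutativeSemigroup as CommSemigroupProperties
open import Data.Nat using (ℕ; zero; suc; _+_; _∸_; _≤_; s≤s)
open import Data.Nat.Properties
  using (≤-antisym; ≤-reflexive; m≤n⇒m≤1+n; m+n∸m≡n; +-comm; +-suc; +-commutativeSemigroup; suc-injective)
open import Data.Fin using (Fin; zero; suc; _≟_)
open import Data.Fin.Properties using (any?) renaming (suc-injective to Fin-suc-injective)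
open import Data.Bool using (Bool; true; false; _∧_; _∨_; _xor_; not; if_then_else_)
open import Data.Bool.Properties
  using ( xor-∧-commutativeRing; xor-assoc; xor-comm; xor-same; xor-identityʳ
        ; ∧-comm; ∧-assoc; ∧-zeroʳ; ∧-identityʳ; ∧-distribˡ-xor; ∧-distribʳ-xor; ¬-not )
  renaming (_≟_ to _≟ᵇ_)
open import Data.List using (List; []; _∷_)
open import Data.Product using (_×_; _,_; proj₁; proj₂; ∃; ∃-syntax)
open import Data.Sum using (_⊎_; inj₁; inj₂)
open import Data.Empty using (⊥; ⊥-elim)
open import Relation.Nullary using (yes; no; does)
open import Relation.Nullary.Decidable using (dec-true; dec-false)
open import Relation.Binary.PropositionalEquality
  using (_≡_; _≢_; refl; sym; trans; cong; cong₂; subst; module ≡-Reasoning)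

open CommSemigroupProperties (CommutativeRing.+-commutativeSemigroup xor-∧-commutativeRing)
  using () renaming (interchange to xor-interchange)
open CommSemigroupProperties +-commutativeSemigroup
  using () renaming (interchange to +-interchange; xy∙z≈xz∙y to +-right-comm)
open ≡-Reasoning

private variable n : ℕ

true≢false : ∀ {b} → b ≡ true → b ≡ false → ⊥
true≢false refl ()

∧-true : ∀ {a b} → a ∧ b ≡ true → a ≡ true × b ≡ true
∧-true {true} {true} refl = refl , refl

keep-first : ∀ p q → p ∧ true xor q ∧ false ≡ p
keep-first true  true  = refl
keep-first true  false = refl
keep-first false true  = refl
keep-first false false = refl

keep-second : ∀ p q → p ∧ false xor q ∧ true ≡ q
keep-second true  true  = refl
keep-second true  false = refl
keep-second false true  = refl
keep-second false false = refl

xor-move : ∀ {a b c} → a ≡ b xor c → b ≡ a xor c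
xor-move {b = b} {c} refl = sym (begin
  (b xor c) xor c   ≡⟨ xor-assoc b c c ⟩
  b xor (c xor c)   ≡⟨ cong (b xor_) (xor-same c) ⟩
  b xor false       ≡⟨ xor-identityʳ b ⟩
  b                 ∎)

⊕Σ-cong : {f g : Fin n → Bool} → (∀ i → f i ≡ g i) → ⊕Σ f ≡ ⊕Σ g
⊕Σ-cong {zero}  _ = refl
⊕Σ-cong {suc n} h = cong₂ _xor_ (h zero) (⊕Σ-cong (λ i → h (suc i)))

⊕Σ-zero : (f : Fin n → Bool) → (∀ i → f i ≡ false) → ⊕Σ f ≡ false
⊕Σ-zero {zero}  f h = refl
⊕Σ-zero {suc n} f h = cong₂ _xor_ (h zero) (⊕Σ-zero (λ i → f (suc i)) (λ i → h (suc i)))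

⊕Σ-xor : (f g : Fin n → Bool) → ⊕Σ (λ i → f i xor g i) ≡ ⊕Σ f xor ⊕Σ g
⊕Σ-xor {zero}  f g = refl
⊕Σ-xor {suc n} f g =
  trans (cong ((f zero xor g zero) xor_) (⊕Σ-xor (λ i → f (suc i)) (λ i → g (suc i))))
        (xor-interchange (f zero) (g zero) _ _)

⊕Σ-scale : ∀ b (f : Fin n → Bool) → ⊕Σ (λ i → b ∧ f i) ≡ b ∧ ⊕Σ f
⊕Σ-scale {zero}  b f = sym (∧-zeroʳ b)
⊕Σ-scale {suc n} b f =
  trans (cong ((b ∧ f zero) xor_) (⊕Σ-scale b (λ i → f (suc i))))
        (sym (∧-distribˡ-xor b (f zero) _))

⊕Σ-scaleʳ : ∀ b (f : Fin n → Bool) → ⊕Σ (λ i → f i ∧ b) ≡ ⊕Σ f ∧ b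
⊕Σ-scaleʳ b f =
  trans (⊕Σ-cong (λ i → ∧-comm (f i) b)) (trans (⊕Σ-scale b f) (∧-comm b (⊕Σ f)))

⊕Σ-single : (f : Fin n → Bool) (v : Fin n) → (∀ j → j ≢ v → f j ≡ false) → ⊕Σ f ≡ f v
⊕Σ-single {suc n} f zero h =
  trans (cong (f zero xor_) (⊕Σ-zero (λ i → f (suc i)) (λ i → h (suc i) (λ ()))))
        (xor-identityʳ (f zero))
⊕Σ-single {suc n} f (suc v) h =
  trans (cong (_xor ⊕Σ (λ i → f (suc i))) (h zero (λ ())))
        (⊕Σ-single (λ i → f (suc i)) v (λ j j≢v → h (suc j) (λ e → j≢v (Fin-suc-injective e))))

⊕Σ-swap : ∀ {m} (f : Fin m → Fin n → Bool) →
  ⊕Σ (λ i → ⊕Σ (λ j → f i j)) ≡ ⊕Σ (λ j → ⊕Σ (λ i → f i j))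
⊕Σ-swap {m = zero}  f = sym (⊕Σ-zero (λ j → ⊕Σ (λ i → f i j)) (λ _ → refl))
⊕Σ-swap {m = suc m} f =
  trans (cong (⊕Σ (f zero) xor_) (⊕Σ-swap (λ i → f (suc i))))
        (sym (⊕Σ-xor (f zero) (λ j → ⊕Σ (λ i → f (suc i) j))))


_⊕_ : Vect n → Vect n → Vect n
(x ⊕ y) j = x j xor y j
infixl 6 _⊕_

_·_ : Bool → Vect n → Vect n
(b · x) j = b ∧ x j
infixr 7 _·_

-- the basis vector of v, equivalently the singleton {v}
δ : Fin n → Vect n
δ v x = does (x ≟ v)

∅ : Subset n
∅ _ = false

_∪_ : Subset n → Subset n → Subset n
(S ∪ T) x = S x ∨ T x

_∖_ : Subset n → Subset n → Subset n
(S ∖ T) x = S x ∧ not (T x)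

-- inclusion; note that 'InSpan W x' of Defs is literally 'x ⊆ W'
_⊆_ : Subset n → Subset n → Set
S ⊆ T = ∀ x → S x ≡ true → T x ≡ true

δ-self : (v : Fin n) → δ v v ≡ true
δ-self v = dec-true (v ≟ v) refl

δ-other : {v x : Fin n} → x ≢ v → δ v x ≡ false
δ-other {v = v} {x} x≢v = dec-false (x ≟ v) x≢v

δ-true : {v x : Fin n} → δ v x ≡ true → x ≡ v
δ-true {v = v} {x} e with x ≟ v
... | yes x≡v = x≡v

δ-within : {S : Subset n} {v : Fin n} → S v ≡ true → δ v ⊆ S
δ-within {S = S} Sv x e = subst (λ y → S y ≡ true) (sym (δ-true e)) Sv

∪-introˡ : (S T : Subset n) → S ⊆ (S ∪ T)
∪-introˡ S T x Sx = cong (_∨ T x) Sx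

∪-introʳ : (S T : Subset n) → T ⊆ (S ∪ T)
∪-introʳ S T x Tx with S x
... | true  = refl
... | false = Tx

∪-elim : ∀ {a b} → a ∨ b ≡ true → a ≡ true ⊎ b ≡ true
∪-elim {true}  _ = inj₁ refl
∪-elim {false} e = inj₂ e

∖-intro : ∀ {a b} → a ≡ true → b ≡ false → a ∧ not b ≡ true
∖-intro refl refl = refl

∖-elim : ∀ {a b} → a ∧ not b ≡ true → a ≡ true × b ≡ false
∖-elim {true} {false} refl = refl , refl

∖-⊆ : (S T : Subset n) → (S ∖ T) ⊆ S
∖-⊆ S T x e = proj₁ (∖-elim e)

⊕-within : {S : Subset n} (x y : Vect n) → x ⊆ S → y ⊆ S → (x ⊕ y) ⊆ S
⊕-within x y x⊆S y⊆S j e with x j in xj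
... | true  = x⊆S j xj
... | false = y⊆S j e

·-within : {S : Subset n} (b : Bool) (x : Vect n) → x ⊆ S → (b · x) ⊆ S
·-within b x x⊆S j e = x⊆S j (proj₂ (∧-true e))

pair-decomposition : {a b : Fin n} (x : Vect n) → a ≢ b → x ⊆ (δ a ∪ δ b) →
  ∀ j → x j ≡ (x a · δ a ⊕ x b · δ b) j
pair-decomposition {a = a} {b} x a≢b x⊆ j with j ≟ a
... | yes refl = sym (trans (cong (λ q → x a ∧ true xor x b ∧ q) (δ-other a≢b)) (keep-first (x a) (x b)))
... | no j≢a with j ≟ b
...   | yes refl = sym (keep-second (x a) (x b))
...   | no j≢b = trans (¬-not x≢true) (sym (cong₂ _xor_ (∧-zeroʳ (x a)) (∧-zeroʳ (x b))))
  where
  x≢true : x j ≢ true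
  x≢true e with ∪-elim (x⊆ j e)
  ... | inj₁ ja = j≢a (δ-true ja)
  ... | inj₂ jb = j≢b (δ-true jb)

-- Matrix-vector product: (M *ᵥ x) i = Σ_c x_c M_{ic} is the combination of the
-- columns of M with coefficients x (the expression used by 'IndepCols').

_*ᵥ_ : Mat n → Vect n → Vect n
(M *ᵥ x) i = ⊕Σ (λ c → x c ∧ M i c)

*ᵥ-cong : (M : Mat n) (x y : Vect n) (i : Fin n) →
  (∀ j → M i j ≡ true → x j ≡ y j) → (M *ᵥ x) i ≡ (M *ᵥ y) i
*ᵥ-cong M x y i agree = ⊕Σ-cong termwise
  where
  termwise : ∀ j → x j ∧ M i j ≡ y j ∧ M i j
  termwise j with M i j in Mij
  ... | true  = cong (_∧ true) (agree j Mij)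
  ... | false = trans (∧-zeroʳ (x j)) (sym (∧-zeroʳ (y j)))

*ᵥ-vanish : (M : Mat n) (x : Vect n) (i : Fin n) →
  (∀ j → x j ≡ true → M i j ≡ false) → (M *ᵥ x) i ≡ false
*ᵥ-vanish M x i disjoint = ⊕Σ-zero _ termwise
  where
  termwise : ∀ j → x j ∧ M i j ≡ false
  termwise j with x j in xj
  ... | true  = disjoint j xj
  ... | false = refl

*ᵥ-⊕ : (M : Mat n) (x y : Vect n) (i : Fin n) →
  (M *ᵥ (x ⊕ y)) i ≡ (M *ᵥ x) i xor (M *ᵥ y) i
*ᵥ-⊕ M x y i = trans (⊕Σ-cong (λ c → ∧-distribʳ-xor (M i c) (x c) (y c))) (⊕Σ-xor (λ c → x c ∧ M i c) (λ c → y c ∧ M i c))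

*ᵥ-· : (M : Mat n) (b : Bool) (x : Vect n) (i : Fin n) →
  (M *ᵥ (b · x)) i ≡ b ∧ (M *ᵥ x) i
*ᵥ-· M b x i = trans (⊕Σ-cong (λ c → ∧-assoc b (x c) (M i c))) (⊕Σ-scale b (λ c → x c ∧ M i c))

*ᵥ-δ : (M : Mat n) (v i : Fin n) → (M *ᵥ δ v) i ≡ M i v
*ᵥ-δ M v i =
  trans (⊕Σ-single _ v (λ c c≢v → cong (_∧ M i c) (δ-other c≢v))) (cong (_∧ M i v) (δ-self v))

*ᵥ-single : (M : Mat n) (x : Vect n) (v i : Fin n) → x ⊆ δ v → (M *ᵥ x) i ≡ x v ∧ M i v
*ᵥ-single M x v i x⊆v = ⊕Σ-single _ v off-v
  where
  off-v : ∀ c → c ≢ v → x c ∧ M i c ≡ false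
  off-v c c≢v = cong (_∧ M i c) (¬-not (λ e → c≢v (δ-true (x⊆v c e))))

*ᵥ-pair : (M : Mat n) (x : Vect n) (a b i : Fin n) → a ≢ b → x ⊆ (δ a ∪ δ b) →
  (M *ᵥ x) i ≡ x a ∧ M i a xor x b ∧ M i b
*ᵥ-pair M x a b i a≢b x⊆ = begin
  (M *ᵥ x) i
    ≡⟨ *ᵥ-cong M x _ i (λ j _ → pair-decomposition x a≢b x⊆ j) ⟩
  (M *ᵥ (x a · δ a ⊕ x b · δ b)) i
    ≡⟨ *ᵥ-⊕ M _ _ i ⟩
  (M *ᵥ (x a · δ a)) i xor (M *ᵥ (x b · δ b)) i
    ≡⟨ cong₂ _xor_ (*ᵥ-· M (x a) (δ a) i) (*ᵥ-· M (x b) (δ b) i) ⟩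
  x a ∧ (M *ᵥ δ a) i xor x b ∧ (M *ᵥ δ b) i
    ≡⟨ cong₂ (λ p q → x a ∧ p xor x b ∧ q) (*ᵥ-δ M a i) (*ᵥ-δ M b i) ⟩
  x a ∧ M i a xor x b ∧ M i b ∎

-- Column shifts.  'shift M κ' adds to every column c of M the combination κ c
-- of columns of M; a combination x of its columns is the combination
-- x ⊕ κ ᵀ x of columns of M.  Both the pivot rules and the exchange lemma
-- are instances.

shift : Mat n → (Fin n → Vect n) → Mat n
shift M κ i c = M i c xor (M *ᵥ κ c) i

_ᵀ_ : (Fin n → Vect n) → Vect n → Vect n
(κ ᵀ x) d = ⊕Σ (λ c → x c ∧ κ c d)
infixr 7 _ᵀ_

ᵀ-within : {D : Subset n} (κ : Fin n → Vect n) → (∀ c → κ c ⊆ D) → ∀ x → (κ ᵀ x) ⊆ D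
ᵀ-within {D = D} κ κ⊆D x d e with D d in Dd
... | true  = refl
... | false = ⊥-elim (true≢false e (⊕Σ-zero _ (λ c → trans (cong (x c ∧_) (κ-off c)) (∧-zeroʳ (x c)))))
  where
  κ-off : ∀ c → κ c d ≡ false
  κ-off c = ¬-not (λ e′ → true≢false (κ⊆D c d e′) Dd)

*ᵥ-ᵀ : (M : Mat n) (κ : Fin n → Vect n) (x : Vect n) (i : Fin n) →
  ⊕Σ (λ c → x c ∧ (M *ᵥ κ c) i) ≡ (M *ᵥ (κ ᵀ x)) i
*ᵥ-ᵀ M κ x i = begin
  ⊕Σ (λ c → x c ∧ ⊕Σ (λ d → κ c d ∧ M i d))
    ≡⟨ ⊕Σ-cong (λ c → sym (⊕Σ-scale (x c) (λ d → κ c d ∧ M i d))) ⟩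
  ⊕Σ (λ c → ⊕Σ (λ d → x c ∧ (κ c d ∧ M i d)))
    ≡⟨ ⊕Σ-swap (λ c d → x c ∧ (κ c d ∧ M i d)) ⟩
  ⊕Σ (λ d → ⊕Σ (λ c → x c ∧ (κ c d ∧ M i d)))
    ≡⟨ ⊕Σ-cong (λ d → trans (⊕Σ-cong (λ c → sym (∧-assoc (x c) (κ c d) (M i d))))
                            (⊕Σ-scaleʳ (M i d) (λ c → x c ∧ κ c d))) ⟩
  ⊕Σ (λ d → ⊕Σ (λ c → x c ∧ κ c d) ∧ M i d) ∎

shift-*ᵥ : (M : Mat n) (κ : Fin n → Vect n) (x : Vect n) (i : Fin n) →
  (shift M κ *ᵥ x) i ≡ (M *ᵥ (x ⊕ κ ᵀ x)) i
shift-*ᵥ M κ x i = begin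
  ⊕Σ (λ c → x c ∧ (M i c xor (M *ᵥ κ c) i))
    ≡⟨ ⊕Σ-cong (λ c → ∧-distribˡ-xor (x c) (M i c) _) ⟩
  ⊕Σ (λ c → x c ∧ M i c xor x c ∧ (M *ᵥ κ c) i)
    ≡⟨ ⊕Σ-xor (λ c → x c ∧ M i c) (λ c → x c ∧ (M *ᵥ κ c) i) ⟩
  (M *ᵥ x) i xor ⊕Σ (λ c → x c ∧ (M *ᵥ κ c) i)
    ≡⟨ cong ((M *ᵥ x) i xor_) (*ᵥ-ᵀ M κ x i) ⟩
  (M *ᵥ x) i xor (M *ᵥ (κ ᵀ x)) i
    ≡⟨ sym (*ᵥ-⊕ M x (κ ᵀ x) i) ⟩
  (M *ᵥ (x ⊕ κ ᵀ x)) i ∎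

card-cong : {S T : Subset n} → (∀ i → S i ≡ T i) → card S ≡ card T
card-cong {zero}  _ = refl
card-cong {suc n} h = cong₂ (λ b m → (if b then 1 else 0) + m) (h zero) (card-cong (λ i → h (suc i)))

card-∅ : (S : Subset n) → (∀ i → S i ≡ false) → card S ≡ 0
card-∅ {zero}  S _ = refl
card-∅ {suc n} S h rewrite h zero = card-∅ (λ i → S (suc i)) (λ i → h (suc i))

card-∪ : (S T : Subset n) → (∀ i → S i ≡ true → T i ≡ false) → card (S ∪ T) ≡ card S + card T
card-∪ {zero}  S T _ = refl
card-∪ {suc n} S T disjoint =
  trans (cong₂ _+_ (count (S zero) (T zero) (disjoint zero))
                   (card-∪ (λ i → S (suc i)) (λ i → T (suc i)) (λ i → disjoint (suc i))))
        (+-interchange (if S zero then 1 else 0) (if T zero then 1 else 0) (card (λ i → S (suc i))) (card (λ i → T (suc i))))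
  where
  count : ∀ a b → (a ≡ true → b ≡ false) →
    (if a ∨ b then 1 else 0) ≡ (if a then 1 else 0) + (if b then 1 else 0)
  count true  true  h = ⊥-elim (true≢false refl (h refl))
  count true  false _ = refl
  count false true  _ = refl
  count false false _ = refl

card-δ : (v : Fin n) → card (δ v) ≡ 1
card-δ {suc n} zero    = cong suc (card-∅ {n} (λ i → δ zero (suc i)) (λ _ → refl))
card-δ {suc n} (suc v) = card-δ v

card-split : (W D : Subset n) → D ⊆ W → card W ≡ card (W ∖ D) + card D
card-split W D D⊆W =
  trans (card-cong (λ x → sym (reassemble x))) (card-∪ (W ∖ D) D (λ x e → proj₂ (∖-elim e)))
  where
  reassemble : ∀ x → ((W ∖ D) ∪ D) x ≡ W x
  reassemble x with W x in Wx | D x in Dx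
  ... | true  | true  = refl
  ... | true  | false = refl
  ... | false | true  = ⊥-elim (true≢false (D⊆W x Dx) Wx)
  ... | false | false = refl

card-remove : (S : Subset n) (v : Fin n) → S v ≡ true → card S ≡ suc (card (S ∖ δ v))
card-remove S v Sv =
  trans (card-split S (δ v) (δ-within Sv))
        (trans (cong (card (S ∖ δ v) +_) (card-δ v)) (+-comm _ 1))

card-nonempty : (S : Subset n) {k : ℕ} → card S ≡ suc k → ∃ λ x → S x ≡ true
card-nonempty S eq with any? (λ x → S x ≟ᵇ true)
... | yes found = found
... | no none with trans (sym (card-∅ S (λ x → ¬-not (λ e → none (x , e))))) eq
...   | ()

card-zero-empty : (S : Subset n) → card S ≡ 0 → ∀ x → S x ≡ false
card-zero-empty S eq x with S x in Sx
... | false = refl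
... | true with trans (sym eq) (card-remove S x Sx)
...   | ()

card-drop : (S : Subset n) {v : Fin n} {k : ℕ} → S v ≡ true → card S ≡ suc k → card (S ∖ δ v) ≡ k
card-drop S {v} Sv eq = suc-injective (trans (sym (card-remove S v Sv)) eq)

-- Spanning and bases.  'Spans u v R C B μ': on the rows R, every column
-- c ∈ C of u is the combination μ c, supported on B, of the columns of v.

Spans : Mat n → Mat n → Subset n → Subset n → Subset n → (Fin n → Vect n) → Set
Spans u v R C B μ = ∀ c → C c ≡ true → μ c ⊆ B × (∀ i → R i ≡ true → u i c ≡ (v *ᵥ μ c) i)

record Basis (M : Mat n) (W B : Subset n) : Set where
  field
    within      : B ⊆ W
    independent : IndepCols M W B
    coeff       : Fin n → Vect n
    spanning    : Spans M M W W B coeff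

drop-unused : (u v : Mat n) (R C B : Subset n) (μ : Fin n → Vect n) (b : Fin n) →
  Spans u v R C B μ → (∀ c → C c ≡ true → μ c b ≡ false) → Spans u v R C (B ∖ δ b) μ
drop-unused u v R C B μ b span unused c Cc = avoids-b , proj₂ (span c Cc)
  where
  avoids-b : μ c ⊆ (B ∖ δ b)
  avoids-b j e = ∖-intro (proj₁ (span c Cc) j e) (δ-other {v = b} {x = j} (λ { refl → true≢false e (unused c Cc) }))

shift-independent : (u : Mat n) (κ : Fin n → Vect n) (R C D : Subset n) →
  (∀ c → κ c ⊆ D) → D ⊆ C → IndepCols u R C → IndepCols (shift u κ) R (C ∖ D)
shift-independent u κ R C D κ⊆D D⊆C indep l l⊆ vanish c =
  ¬-not (λ lc → true≢false (cong₂ _xor_ lc (off-D c (proj₂ (∖-elim (l⊆ c lc))))) (lifted-zero c))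
  where
  lifted-within : (l ⊕ κ ᵀ l) ⊆ C
  lifted-within = ⊕-within l (κ ᵀ l) (λ j e → ∖-⊆ C D j (l⊆ j e)) (λ j e → D⊆C j (ᵀ-within κ κ⊆D l j e))
  lifted-zero : ∀ j → (l ⊕ κ ᵀ l) j ≡ false
  lifted-zero = indep (l ⊕ κ ᵀ l) lifted-within (λ i Ri → trans (sym (shift-*ᵥ u κ l i)) (vanish i Ri))
  off-D : ∀ j → D j ≡ false → (κ ᵀ l) j ≡ false
  off-D j Dj = ¬-not (λ e → true≢false (ᵀ-within κ κ⊆D l j e) Dj)

-- Using a column c₀ with μ c₀ b = true to eliminate b from all other columns:
-- the shifted columns of C ∖ {c₀} are spanned without b.
exchange-spans : (u v : Mat n) (R C B : Subset n) (μ : Fin n → Vect n) (b c₀ : Fin n) →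
  Spans u v R C B μ → C c₀ ≡ true → μ c₀ b ≡ true →
  Spans (shift u (λ c → μ c b · δ c₀)) v R (C ∖ δ c₀) (B ∖ δ b) (λ c → μ c ⊕ μ c b · μ c₀)
exchange-spans u v R C B μ b c₀ span Cc₀ μc₀b c C′c = avoids-b , columns
  where
  Cc = ∖-⊆ C (δ c₀) c C′c
  b-eliminated : μ c b xor μ c b ∧ μ c₀ b ≡ false
  b-eliminated = trans (cong (λ p → μ c b xor μ c b ∧ p) μc₀b)
                       (trans (cong (μ c b xor_) (∧-identityʳ (μ c b))) (xor-same (μ c b)))
  avoids-b : (μ c ⊕ μ c b · μ c₀) ⊆ (B ∖ δ b)
  avoids-b j e = ∖-intro (⊕-within (μ c) _ (proj₁ (span c Cc)) (·-within (μ c b) (μ c₀) (proj₁ (span c₀ Cc₀))) j e)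
                         (δ-other {v = b} {x = j} (λ { refl → true≢false e b-eliminated }))
  columns : ∀ i → R i ≡ true → shift u (λ c → μ c b · δ c₀) i c ≡ (v *ᵥ (μ c ⊕ μ c b · μ c₀)) i
  columns i Ri = begin
    u i c xor (u *ᵥ (μ c b · δ c₀)) i
      ≡⟨ cong (u i c xor_) (trans (*ᵥ-· u (μ c b) (δ c₀) i) (cong (μ c b ∧_) (*ᵥ-δ u c₀ i))) ⟩
    u i c xor μ c b ∧ u i c₀
      ≡⟨ cong₂ (λ p q → p xor μ c b ∧ q) (proj₂ (span c Cc) i Ri) (proj₂ (span c₀ Cc₀) i Ri) ⟩
    (v *ᵥ μ c) i xor μ c b ∧ (v *ᵥ μ c₀) i
      ≡⟨ cong ((v *ᵥ μ c) i xor_) (sym (*ᵥ-· v (μ c b) (μ c₀) i)) ⟩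
    (v *ᵥ μ c) i xor (v *ᵥ (μ c b · μ c₀)) i
      ≡⟨ sym (*ᵥ-⊕ v (μ c) (μ c b · μ c₀) i) ⟩
    (v *ᵥ (μ c ⊕ μ c b · μ c₀)) i ∎

-- Induction on |B|: pick b ∈ B; if some column uses b, trade it for b.
exchange : (R : Subset n) (v : Mat n) (k : ℕ) (B : Subset n) → card B ≡ k →
  (u : Mat n) (C : Subset n) (μ : Fin n → Vect n) →
  IndepCols u R C → Spans u v R C B μ → card C ≤ k
exchange R v zero B cardB u C μ indep span = ≤-reflexive (card-∅ C no-column)
  where
  column-zero : ∀ c → C c ≡ true → ∀ i → R i ≡ true → (u *ᵥ δ c) i ≡ false
  column-zero c Cc i Ri = trans (*ᵥ-δ u c i) (trans (proj₂ (span c Cc) i Ri)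
    (*ᵥ-vanish v (μ c) i (λ j e → ⊥-elim (true≢false (proj₁ (span c Cc) j e) (card-zero-empty B cardB j)))))
  no-column : ∀ c → C c ≡ false
  no-column c = ¬-not (λ Cc → true≢false (δ-self c) (indep (δ c) (δ-within Cc) (column-zero c Cc) c))
exchange R v (suc k) B cardB u C μ indep span with card-nonempty B cardB
... | b , Bb with any? (λ c → C c ∧ μ c b ≟ᵇ true)
...   | no unused = m≤n⇒m≤1+n (exchange R v k (B ∖ δ b) (card-drop B Bb cardB) u C μ indep
          (drop-unused u v R C B μ b span (λ c Cc → ¬-not (λ e → unused (c , cong₂ _∧_ Cc e)))))
...   | yes (c₀ , used) with ∧-true used
...     | Cc₀ , μc₀b = subst (_≤ suc k) (sym (card-remove C c₀ Cc₀))
          (s≤s (exchange R v k (B ∖ δ b) (card-drop B Bb cardB)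
                  (shift u (λ c → μ c b · δ c₀)) (C ∖ δ c₀) (λ c → μ c ⊕ μ c b · μ c₀)
                  (shift-independent u _ R C (δ c₀) (λ c → ·-within (μ c b) (δ c₀) (λ _ e → e))
                                     (δ-within Cc₀) indep)
                  (exchange-spans u v R C B μ b c₀ span Cc₀ μc₀b)))

basis-maximal : {M : Mat n} {W B : Subset n} → Basis M W B →
  (C : Subset n) → C ⊆ W → IndepCols M W C → card C ≤ card B
basis-maximal {M = M} {W} {B} basis C C⊆W indepC =
  exchange W M (card B) B refl M C coeff indepC (λ c Cc → spanning c (C⊆W c Cc))
  where open Basis basis

rank-is-basis-size : {M : Mat n} {W B : Subset n} {r : ℕ} → Basis M W B → IsRank M W r → r ≡ card B
rank-is-basis-size basis ((C , C⊆W , indepC , cardC≡r) , maximal) =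
  ≤-antisym (subst (_≤ _) cardC≡r (basis-maximal basis C C⊆W indepC)) (maximal _ within independent)
  where open Basis basis

-- For D ⊆ W,
-- M′_{W∖D,W∖D} is then the Schur complement of M_{D,D} in M_{W,W}.

record Pivot (M M′ : Mat n) (D : Subset n) : Set where
  field
    κ           : Fin n → Vect n
    κ-within    : ∀ c → κ c ⊆ D
    is-shift    : ∀ i c → M′ i c ≡ shift M κ i c
    rows-vanish : ∀ d c → D d ≡ true → M′ d c ≡ false
    block-indep : IndepCols M D D

module Pivoting {M M′ : Mat n} {D W B′ : Subset n} (pivot : Pivot M M′ D)
  (symmetric′ : Symmetric M′) (D⊆W : D ⊆ W) (basis′ : Basis M′ (W ∖ D) B′) where

  open Pivot pivot
  open Basis basis′ using () renaming
    (within to within′; independent to independent′; coeff to coeff′; spanning to spanning′)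

  M′-*ᵥ : ∀ x i → (M′ *ᵥ x) i ≡ (M *ᵥ (x ⊕ κ ᵀ x)) i
  M′-*ᵥ x i = trans (⊕Σ-cong (λ c → cong (x c ∧_) (is-shift i c))) (shift-*ᵥ M κ x i)

  cols-vanish : ∀ i d → D d ≡ true → M′ i d ≡ false
  cols-vanish i d Dd = trans (symmetric′ i d) (rows-vanish d i Dd)

  within : (B′ ∪ D) ⊆ W
  within j e with ∪-elim e
  ... | inj₁ B′j = ∖-⊆ W D j (within′ j B′j)
  ... | inj₂ Dj  = D⊆W j Dj

  -- If M l = 0 on W, then first the pivot rows force κ ᵀ l = 0, hence M′ l = 0
  -- on W; so the part of l off D vanishes by independence in M′, and the part
  -- on D by invertibility of the pivot block.
  independent : IndepCols M W (B′ ∪ D)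
  independent l l⊆ vanish = block-indep l l⊆D (λ d Dd → vanish d (D⊆W d Dd))
    where
    on-pivot-rows : ∀ d → D d ≡ true → (M *ᵥ (κ ᵀ l)) d ≡ false
    on-pivot-rows d Dd = begin
      (M *ᵥ (κ ᵀ l)) d
        ≡⟨ cong (_xor (M *ᵥ (κ ᵀ l)) d) (sym (vanish d (D⊆W d Dd))) ⟩
      (M *ᵥ l) d xor (M *ᵥ (κ ᵀ l)) d
        ≡⟨ sym (*ᵥ-⊕ M l (κ ᵀ l) d) ⟩
      (M *ᵥ (l ⊕ κ ᵀ l)) d
        ≡⟨ sym (M′-*ᵥ l d) ⟩
      (M′ *ᵥ l) d
        ≡⟨ *ᵥ-vanish M′ l d (λ j _ → rows-vanish d j Dd) ⟩
      false ∎
    shift-zero : ∀ d → (κ ᵀ l) d ≡ false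
    shift-zero = block-indep (κ ᵀ l) (ᵀ-within κ κ-within l) on-pivot-rows
    M′l-zero : ∀ i → W i ≡ true → (M′ *ᵥ l) i ≡ false
    M′l-zero i Wi = begin
      (M′ *ᵥ l) i
        ≡⟨ M′-*ᵥ l i ⟩
      (M *ᵥ (l ⊕ κ ᵀ l)) i
        ≡⟨ *ᵥ-⊕ M l (κ ᵀ l) i ⟩
      (M *ᵥ l) i xor (M *ᵥ (κ ᵀ l)) i
        ≡⟨ cong₂ _xor_ (vanish i Wi)
                       (*ᵥ-vanish M (κ ᵀ l) i (λ j e → ⊥-elim (true≢false e (shift-zero j)))) ⟩
      false ∎
    off-D⊆B′ : (l ∖ D) ⊆ B′
    off-D⊆B′ j e with ∖-elim e
    ... | lj , Dj with ∪-elim (l⊆ j lj)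
    ...   | inj₁ B′j = B′j
    ...   | inj₂ Dj′ = ⊥-elim (true≢false Dj′ Dj)
    same-on-M′ : ∀ i j → M′ i j ≡ true → (l ∖ D) j ≡ l j
    same-on-M′ i j M′ij with D j in Dj
    ... | true  = ⊥-elim (true≢false M′ij (cols-vanish i j Dj))
    ... | false = ∧-identityʳ (l j)
    off-D-zero : ∀ j → (l ∖ D) j ≡ false
    off-D-zero = independent′ (l ∖ D) off-D⊆B′
      (λ i W′i → trans (*ᵥ-cong M′ (l ∖ D) l i (same-on-M′ i)) (M′l-zero i (∖-⊆ W D i W′i)))
    l⊆D : l ⊆ D
    l⊆D j lj with D j in Dj
    ... | true  = refl
    ... | false = ⊥-elim (true≢false (∖-intro lj Dj) (off-D-zero j))

  -- a column c ∉ D of M is the lift of its expression in M′: add the pivot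
  -- combination κ c and the coefficient shift κ ᵀ (coeff′ c)
  lift : Fin n → Vect n
  lift c = (coeff′ c ⊕ κ ᵀ coeff′ c) ⊕ κ c

  lift-within : ∀ c → (W ∖ D) c ≡ true → lift c ⊆ (B′ ∪ D)
  lift-within c W′c =
    ⊕-within (coeff′ c ⊕ κ ᵀ coeff′ c) (κ c)
      (⊕-within (coeff′ c) (κ ᵀ coeff′ c)
        (λ j e → ∪-introˡ B′ D j (proj₁ (spanning′ c W′c) j e))
        (λ j e → ∪-introʳ B′ D j (ᵀ-within κ κ-within (coeff′ c) j e)))
      (λ j e → ∪-introʳ B′ D j (κ-within c j e))

  M′-column : ∀ c → (W ∖ D) c ≡ true → ∀ i → W i ≡ true → M′ i c ≡ (M′ *ᵥ coeff′ c) i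
  M′-column c W′c i Wi with D i in Di
  ... | true  = trans (rows-vanish i c Di) (sym (*ᵥ-vanish M′ (coeff′ c) i (λ j _ → rows-vanish i j Di)))
  ... | false = proj₂ (spanning′ c W′c) i (∖-intro Wi Di)

  lift-column : ∀ c → (W ∖ D) c ≡ true → ∀ i → W i ≡ true → M i c ≡ (M *ᵥ lift c) i
  lift-column c W′c i Wi = begin
    M i c
      ≡⟨ xor-move (is-shift i c) ⟩
    M′ i c xor (M *ᵥ κ c) i
      ≡⟨ cong (_xor (M *ᵥ κ c) i) (trans (M′-column c W′c i Wi) (M′-*ᵥ (coeff′ c) i)) ⟩
    (M *ᵥ (coeff′ c ⊕ κ ᵀ coeff′ c)) i xor (M *ᵥ κ c) i
      ≡⟨ sym (*ᵥ-⊕ M (coeff′ c ⊕ κ ᵀ coeff′ c) (κ c) i) ⟩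
    (M *ᵥ lift c) i ∎

  coeff : Fin n → Vect n
  coeff c = if D c then δ c else lift c

  spanning : Spans M M W W (B′ ∪ D) coeff
  spanning c Wc with D c in Dc
  ... | true  = δ-within (∪-introʳ B′ D c Dc) , (λ i _ → sym (*ᵥ-δ M c i))
  ... | false = lift-within c (∖-intro Wc Dc) , lift-column c (∖-intro Wc Dc)

  basis : Basis M W (B′ ∪ D)
  basis = record { within = within ; independent = independent ; coeff = coeff ; spanning = spanning }

module Isolating {M : Mat n} {D W B : Subset n} (symmetric : Symmetric M)
  (rows-vanish : ∀ d c → D d ≡ true → W c ≡ true → M d c ≡ false)
  (basis′ : Basis M (W ∖ D) B) where

  open Basis basis′ using () renaming
    (within to within′; independent to independent′; coeff to coeff′; spanning to spanning′)

  coeff : Fin n → Vect n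
  coeff c = if D c then ∅ else coeff′ c

  -- off D the old expression still holds on the rows D, where both sides vanish
  old-column : ∀ c → (W ∖ D) c ≡ true → ∀ i → W i ≡ true → M i c ≡ (M *ᵥ coeff′ c) i
  old-column c W′c i Wi with D i in Di
  ... | true  = trans (rows-vanish i c Di (∖-⊆ W D c W′c))
      (sym (*ᵥ-vanish M (coeff′ c) i
        (λ j e → rows-vanish i j Di (∖-⊆ W D j (within′ j (proj₁ (spanning′ c W′c) j e))))))
  ... | false = proj₂ (spanning′ c W′c) i (∖-intro Wi Di)

  spanning : Spans M M W W B coeff
  spanning c Wc with D c in Dc
  ... | true  = (λ _ ()) , (λ i Wi → trans (trans (symmetric i c) (rows-vanish c i Dc Wi))
                                         (sym (*ᵥ-vanish M ∅ i (λ _ ()))))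
  ... | false = proj₁ (spanning′ c (∖-intro Wc Dc)) , old-column c (∖-intro Wc Dc)

  basis : Basis M W B
  basis = record
    { within      = λ j e → ∖-⊆ W D j (within′ j e)
    ; independent = λ l l⊆B vanish → independent′ l l⊆B (λ i W′i → vanish i (∖-⊆ W D i W′i))
    ; coeff       = coeff
    ; spanning    = spanning
    }

HasBasis : Mat n → Subset n → ℕ → Set
HasBasis M W m = ∃[ B ] (Basis M W B × card W ≡ card B + m)

empty-basis : {n : ℕ} (M : Mat n) (W : Subset n) → (∀ x → W x ≡ false) → HasBasis M W 0
empty-basis {n} M W empty = ∅ , basis , trans (card-∅ W empty) (sym (cong (_+ 0) (card-∅ {n} ∅ (λ _ → refl))))
  where
  basis : Basis M W ∅
  basis = record
    { within      = λ _ ()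
    ; independent = λ l l⊆∅ _ c → ¬-not (λ e → true≢false (l⊆∅ c e) refl)
    ; coeff       = λ _ → ∅
    ; spanning    = λ c Wc → ⊥-elim (true≢false Wc (empty c))
    }

-- a pivot step leaves the count unchanged: the pivot vertices join the basis
pivot-extend : {M M′ : Mat n} {D W : Subset n} {m : ℕ} → Pivot M M′ D → Symmetric M′ → D ⊆ W →
  HasBasis M′ (W ∖ D) m → HasBasis M W m
pivot-extend {M = M} {D = D} {W} {m} pivot symmetric′ D⊆W (B′ , basis′ , card′) =
  B′ ∪ D , Pivoting.basis pivot symmetric′ D⊆W basis′ , counting
  where
  counting : card W ≡ card (B′ ∪ D) + m
  counting = begin
    card W                 ≡⟨ card-split W D D⊆W ⟩
    card (W ∖ D) + card D  ≡⟨ cong (_+ card D) card′ ⟩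
    card B′ + m + card D   ≡⟨ +-right-comm (card B′) m (card D) ⟩
    card B′ + card D + m   ≡⟨ cong (_+ m) (sym (card-∪ B′ D (λ j e → proj₂ (∖-elim (Basis.within basis′ j e))))) ⟩
    card (B′ ∪ D) + m      ∎

isolated-extend : {M : Mat n} {W : Subset n} {m : ℕ} (v : Fin n) → Symmetric M →
  (∀ c → W c ≡ true → M v c ≡ false) → W v ≡ true →
  HasBasis M (W ∖ δ v) m → HasBasis M W (suc m)
isolated-extend {M = M} {W} {m} v symmetric row-v Wv (B , basis′ , card′) =
  B , Isolating.basis symmetric rows-vanish basis′ , counting
  where
  rows-vanish : ∀ d c → δ v d ≡ true → W c ≡ true → M d c ≡ false
  rows-vanish d c e Wc = subst (λ x → M x c ≡ false) (sym (δ-true e)) (row-v c Wc)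
  counting : card W ≡ card B + suc m
  counting = trans (card-remove W v Wv) (trans (cong suc card′) (sym (+-suc (card B) m)))

ruleDom : Rule n → Subset n
ruleDom (gpr v)     = δ v
ruleDom (gdr v₁ v₂) = δ v₁ ∪ δ v₂
ruleDom (gnr v)     = δ v

apply-symmetric : {M : Mat n} (γ : Rule n) (S : Subset n) → Symmetric M →
  Symmetric (adj (apply γ (st S M)))
apply-symmetric {M = M} (gpr v) S symmetric x y =
  cong₂ _xor_ (symmetric x y) (∧-comm (M v x) (M v y))
apply-symmetric {M = M} (gdr v₁ v₂) S symmetric x y =
  cong₂ _xor_ (symmetric x y)
    (trans (xor-comm (M v₁ x ∧ M v₂ y) (M v₂ x ∧ M v₁ y))
           (cong₂ _xor_ (∧-comm (M v₂ x) (M v₁ y)) (∧-comm (M v₁ x) (M v₂ y))))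
apply-symmetric (gnr v) S symmetric = symmetric

loop-invertible : (M : Mat n) (v : Fin n) → M v v ≡ true → IndepCols M (δ v) (δ v)
loop-invertible M v Mvv l l⊆v vanish c =
  ¬-not (λ lc → true≢false lc (subst (λ x → l x ≡ false) (sym (δ-true (l⊆v c lc))) lv-zero))
  where
  lv-zero : l v ≡ false
  lv-zero = begin
    l v               ≡⟨ sym (∧-identityʳ (l v)) ⟩
    l v ∧ true        ≡⟨ cong (l v ∧_) (sym Mvv) ⟩
    l v ∧ M v v       ≡⟨ sym (*ᵥ-single M l v v l⊆v) ⟩
    (M *ᵥ l) v        ≡⟨ vanish v (δ-self v) ⟩
    false             ∎

edge-invertible : (M : Mat n) (v₁ v₂ : Fin n) → v₁ ≢ v₂ →
  M v₁ v₁ ≡ false → M v₂ v₂ ≡ false → M v₁ v₂ ≡ true → M v₂ v₁ ≡ true →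
  IndepCols M (δ v₁ ∪ δ v₂) (δ v₁ ∪ δ v₂)
edge-invertible M v₁ v₂ v₁≢v₂ M₁₁ M₂₂ M₁₂ M₂₁ l l⊆ vanish c =
  ¬-not (λ lc → true≢false lc (on-pair (l⊆ c lc)))
  where
  row : ∀ i → (M *ᵥ l) i ≡ l v₁ ∧ M i v₁ xor l v₂ ∧ M i v₂
  row i = *ᵥ-pair M l v₁ v₂ i v₁≢v₂ l⊆
  l₂-zero : l v₂ ≡ false
  l₂-zero = begin
    l v₂                                   ≡⟨ sym (keep-second (l v₁) (l v₂)) ⟩
    l v₁ ∧ false xor l v₂ ∧ true           ≡⟨ cong₂ (λ p q → l v₁ ∧ p xor l v₂ ∧ q) (sym M₁₁) (sym M₁₂) ⟩
    l v₁ ∧ M v₁ v₁ xor l v₂ ∧ M v₁ v₂      ≡⟨ sym (row v₁) ⟩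
    (M *ᵥ l) v₁                            ≡⟨ vanish v₁ (∪-introˡ (δ v₁) (δ v₂) v₁ (δ-self v₁)) ⟩
    false                                  ∎
  l₁-zero : l v₁ ≡ false
  l₁-zero = begin
    l v₁                                   ≡⟨ sym (keep-first (l v₁) (l v₂)) ⟩
    l v₁ ∧ true xor l v₂ ∧ false           ≡⟨ cong₂ (λ p q → l v₁ ∧ p xor l v₂ ∧ q) (sym M₂₁) (sym M₂₂) ⟩
    l v₁ ∧ M v₂ v₁ xor l v₂ ∧ M v₂ v₂      ≡⟨ sym (row v₂) ⟩
    (M *ᵥ l) v₂                            ≡⟨ vanish v₂ (∪-introʳ (δ v₁) (δ v₂) v₂ (δ-self v₂)) ⟩
    false                                  ∎
  on-pair : (δ v₁ ∪ δ v₂) c ≡ true → l c ≡ false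
  on-pair e with ∪-elim e
  ... | inj₁ e₁ = subst (λ x → l x ≡ false) (sym (δ-true e₁)) l₁-zero
  ... | inj₂ e₂ = subst (λ x → l x ≡ false) (sym (δ-true e₂)) l₂-zero

-- the correction term M_{ai} M_{bc} of a rule is column a of M scaled by M_{bc}
product-as-column : (M : Mat n) → Symmetric M → ∀ a b i c →
  M a i ∧ M b c ≡ (M *ᵥ (M b c · δ a)) i
product-as-column M symmetric a b i c = begin
  M a i ∧ M b c          ≡⟨ cong (_∧ M b c) (symmetric a i) ⟩
  M i a ∧ M b c          ≡⟨ ∧-comm (M i a) (M b c) ⟩
  M b c ∧ M i a          ≡⟨ cong (M b c ∧_) (sym (*ᵥ-δ M a i)) ⟩
  M b c ∧ (M *ᵥ δ a) i   ≡⟨ sym (*ᵥ-· M (M b c) (δ a) i) ⟩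
  (M *ᵥ (M b c · δ a)) i ∎

gpr-pivot : {M : Mat n} (S : Subset n) (v : Fin n) → Symmetric M → M v v ≡ true →
  Pivot M (adj (apply (gpr v) (st S M))) (δ v)
gpr-pivot {M = M} S v symmetric Mvv = record
  { κ           = λ c → M v c · δ v
  ; κ-within    = λ c → ·-within (M v c) (δ v) (λ _ e → e)
  ; is-shift    = λ i c → cong (M i c xor_) (product-as-column M symmetric v v i c)
  ; rows-vanish = rows-vanish
  ; block-indep = loop-invertible M v Mvv
  }
  where
  rows-vanish : ∀ d c → δ v d ≡ true → M d c xor M v d ∧ M v c ≡ false
  rows-vanish d c e rewrite δ-true {v = v} {x = d} e | Mvv = xor-same (M v c)

gdr-pivot : {M : Mat n} (S : Subset n) (v₁ v₂ : Fin n) → Symmetric M → v₁ ≢ v₂ →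
  M v₁ v₁ ≡ false → M v₂ v₂ ≡ false → M v₁ v₂ ≡ true →
  Pivot M (adj (apply (gdr v₁ v₂) (st S M))) (δ v₁ ∪ δ v₂)
gdr-pivot {M = M} S v₁ v₂ symmetric v₁≢v₂ M₁₁ M₂₂ M₁₂ = record
  { κ           = λ c → M v₂ c · δ v₁ ⊕ M v₁ c · δ v₂
  ; κ-within    = λ c → ⊕-within (M v₂ c · δ v₁) (M v₁ c · δ v₂)
                          (·-within (M v₂ c) (δ v₁) (∪-introˡ (δ v₁) (δ v₂)))
                          (·-within (M v₁ c) (δ v₂) (∪-introʳ (δ v₁) (δ v₂)))
  ; is-shift    = λ i c → cong (M i c xor_)
                    (trans (cong₂ _xor_ (product-as-column M symmetric v₁ v₂ i c)
                                        (product-as-column M symmetric v₂ v₁ i c))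
                           (sym (*ᵥ-⊕ M (M v₂ c · δ v₁) (M v₁ c · δ v₂) i)))
  ; rows-vanish = rows-vanish
  ; block-indep = edge-invertible M v₁ v₂ v₁≢v₂ M₁₁ M₂₂ M₁₂ M₂₁
  }
  where
  M₂₁ : M v₂ v₁ ≡ true
  M₂₁ = trans (symmetric v₂ v₁) M₁₂
  rows-vanish : ∀ d c → (δ v₁ ∪ δ v₂) d ≡ true →
    M d c xor (M v₁ d ∧ M v₂ c xor M v₂ d ∧ M v₁ c) ≡ false
  rows-vanish d c e with ∪-elim e
  ... | inj₁ e₁ rewrite δ-true {v = v₁} {x = d} e₁ | M₁₁ | M₂₁ = xor-same (M v₁ c)
  ... | inj₂ e₂ rewrite δ-true {v = v₂} {x = d} e₂ | M₁₂ | M₂₂ =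
    trans (cong (M v₂ c xor_) (xor-identityʳ (M v₂ c))) (xor-same (M v₂ c))

isolated-row : {M : Mat n} {S : Subset n} (v : Fin n) → Applies (gnr v) (st S M) →
  ∀ c → S c ≡ true → M v c ≡ false
isolated-row v (_ , Mvv , no-neighbour) c Sc with c ≟ v
... | yes refl = Mvv
... | no c≢v   = no-neighbour c Sc c≢v

Dom : List (Rule n) → Subset n → Set
Dom σ W = ∀ x → (W x ≡ true → InDom σ x) × (InDom σ x → W x ≡ true)

ruleDom-sound : (γ : Rule n) (x : Fin n) → InRuleDom γ x → ruleDom γ x ≡ true
ruleDom-sound (gpr v)     x refl       = δ-self v
ruleDom-sound (gdr v₁ v₂) x (inj₁ refl) = ∪-introˡ (δ v₁) (δ v₂) v₁ (δ-self v₁)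
ruleDom-sound (gdr v₁ v₂) x (inj₂ refl) = ∪-introʳ (δ v₁) (δ v₂) v₂ (δ-self v₂)
ruleDom-sound (gnr v)     x refl       = δ-self v

ruleDom-complete : (γ : Rule n) (x : Fin n) → ruleDom γ x ≡ true → InRuleDom γ x
ruleDom-complete (gpr v)     x e = δ-true e
ruleDom-complete (gdr v₁ v₂) x e with ∪-elim e
... | inj₁ e₁ = inj₁ (δ-true e₁)
... | inj₂ e₂ = inj₂ (δ-true e₂)
ruleDom-complete (gnr v)     x e = δ-true e

remove-elim : (S : Subset n) (v x : Fin n) → remove v S x ≡ true → S x ≡ true × x ≢ v
remove-elim S v x e with x ≟ v
... | no x≢v = e , x≢v

apply-verts : (γ : Rule n) (s : State n) (x : Fin n) →
  verts (apply γ s) x ≡ true → verts s x ≡ true × ruleDom γ x ≡ false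
apply-verts (gpr v) (st S M) x e with remove-elim S v x e
... | Sx , x≢v = Sx , δ-other x≢v
apply-verts (gdr v₁ v₂) (st S M) x e with remove-elim (remove v₁ S) v₂ x e
... | S₁x , x≢v₂ with remove-elim S v₁ x S₁x
...   | Sx , x≢v₁ = Sx , cong₂ _∨_ (δ-other x≢v₁) (δ-other x≢v₂)
apply-verts (gnr v) (st S M) x e with remove-elim S v x e
... | Sx , x≢v = Sx , δ-other x≢v

rule-in-verts : (γ : Rule n) (s : State n) → Applies γ s → ruleDom γ ⊆ verts s
rule-in-verts (gpr v)     (st S M) (Sv , _)           = δ-within Sv
rule-in-verts (gdr v₁ v₂) (st S M) (_ , Sv₁ , Sv₂ , _) x e with ∪-elim e
... | inj₁ e₁ = δ-within Sv₁ x e₁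
... | inj₂ e₂ = δ-within Sv₂ x e₂
rule-in-verts (gnr v)     (st S M) (Sv , _)           = δ-within Sv

strategy-in-verts : (σ : List (Rule n)) (s : State n) → Applicable s σ →
  ∀ x → InDom σ x → verts s x ≡ true
strategy-in-verts (γ ∷ σ) s (applies , _) x (inj₁ d) = rule-in-verts γ s applies x (ruleDom-sound γ x d)
strategy-in-verts (γ ∷ σ) s (_ , applicable) x (inj₂ d) =
  proj₁ (apply-verts γ s x (strategy-in-verts σ (apply γ s) applicable x d))

domain-head : (γ : Rule n) (σ : List (Rule n)) (W : Subset n) → Dom (γ ∷ σ) W → ruleDom γ ⊆ W
domain-head γ σ W dom x e = proj₂ (dom x) (inj₁ (ruleDom-complete γ x e))

domain-tail : (γ : Rule n) (σ : List (Rule n)) (s : State n) (W : Subset n) →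
  Applicable (apply γ s) σ → Dom (γ ∷ σ) W → Dom σ (W ∖ ruleDom γ)
domain-tail γ σ s W applicable dom x = forward , backward
  where
  forward : (W ∖ ruleDom γ) x ≡ true → InDom σ x
  forward e with ∖-elim e
  ... | Wx , outside with proj₁ (dom x) Wx
  ...   | inj₁ d = ⊥-elim (true≢false (ruleDom-sound γ x d) outside)
  ...   | inj₂ d = d
  backward : InDom σ x → (W ∖ ruleDom γ) x ≡ true
  backward d = ∖-intro (proj₂ (dom x) (inj₂ d))
                       (proj₂ (apply-verts γ s x (strategy-in-verts σ (apply γ s) applicable x d)))

rule-step : (γ : Rule n) (σ : List (Rule n)) (S : Subset n) (M : Mat n) → Symmetric M →
  Applies γ (st S M) → (W : Subset n) → ruleDom γ ⊆ W → W ⊆ S →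
  HasBasis (adj (apply γ (st S M))) (W ∖ ruleDom γ) (countGnr σ) → HasBasis M W (countGnr (γ ∷ σ))
rule-step (gpr v) σ S M symmetric (_ , Mvv) W dom⊆W _ =
  pivot-extend (gpr-pivot S v symmetric Mvv) (apply-symmetric (gpr v) S symmetric) dom⊆W
rule-step (gdr v₁ v₂) σ S M symmetric (v₁≢v₂ , _ , _ , M₁₁ , M₂₂ , M₁₂) W dom⊆W _ =
  pivot-extend (gdr-pivot S v₁ v₂ symmetric v₁≢v₂ M₁₁ M₂₂ M₁₂)
               (apply-symmetric (gdr v₁ v₂) S symmetric) dom⊆W
rule-step (gnr v) σ S M symmetric applies W dom⊆W W⊆S =
  isolated-extend v symmetric (λ c Wc → isolated-row {M = M} v applies c (W⊆S c Wc)) (dom⊆W v (δ-self v))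

strategy-basis : (σ : List (Rule n)) (S : Subset n) (M : Mat n) → Symmetric M →
  Applicable (st S M) σ → (W : Subset n) → Dom σ W → HasBasis M W (countGnr σ)
strategy-basis [] S M _ _ W dom = empty-basis M W (λ x → ¬-not (proj₁ (dom x)))
strategy-basis (γ ∷ σ) S M symmetric (applies , applicable) W dom =
  rule-step γ σ S M symmetric applies W (domain-head γ σ W dom)
    (λ x Wx → strategy-in-verts (γ ∷ σ) (st S M) (applies , applicable) x (proj₁ (dom x) Wx))
    (strategy-basis σ (verts s′) (adj s′) (apply-symmetric γ S symmetric) applicable
                    (W ∖ ruleDom γ) (domain-tail γ σ (st S M) W applicable dom))
  where
  s′ = apply γ (st S M)

mainTheorem2 : (n : ℕ) (A : Mat n) → Symmetric A →
    (W : Subset n) → Reducible A W →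
    (σ : List (Rule n)) → Applicable (graph A) σ →
    (∀ x → (W x ≡ true → InDom σ x) × (InDom σ x → W x ≡ true)) →
    (k : ℕ) → IsNullity A W k → countGnr σ ≡ k
mainTheorem2 n A symmetric W _ σ applicable dom k (r , rank , k≡|W|∸r)
  with strategy-basis σ (λ _ → true) A symmetric applicable W dom
... | B , basis , |W|≡|B|+gnr = begin
  countGnr σ                   ≡⟨ sym (m+n∸m≡n (card B) (countGnr σ)) ⟩
  card B + countGnr σ ∸ card B ≡⟨ cong₂ _∸_ (sym |W|≡|B|+gnr) (sym (rank-is-basis-size basis rank)) ⟩
  card W ∸ r                   ≡⟨ sym k≡|W|∸r ⟩
  k                            ∎
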